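{- The description logics $\mathcal{EL}$ and $\mathcal{EL}^+$ have the $\sqsubseteq$-interpolation property w.r.t. $\Theta_{\mathcal{R}}$-sharing: for all CBoxes $\mathcal{C}_A = GCI_A \cup \mathcal{R}_A$ and $\mathcal{C}_B = GCI_B \cup \mathcal{R}_B$ (with $\mathcal{R}_A = \mathcal{R}_B = \emptyset$ in the case of $\mathcal{EL}$) and all concept descriptions $C, D$ such that $\mathcal{C}_A \cup \mathcal{C}_B \models C \sqsubseteq D$, there exists a concept description $T$ containing only concept names occurring both in $\mathcal{C}_A$ or $C$ and in $\mathcal{C}_B$ or $D$, and only role names in $\Theta_{\mathcal{R}}(N_A) \cap \Theta_{\mathcal{R}}(N_B)$, such that $\mathcal{C}_A \cup \mathcal{C}_B \models C \sqsubseteq T$ and $\mathcal{C}_A \cup \mathcal{C}_B \models T \sqsubseteq D$.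
   Context: Given sets $N_C$ of concept names and $N_R$ of role names, $\mathcal{EL}$ concept descriptions are built from concept names using conjunction $C_1 \sqcap C_2$ and existential restriction $\exists r.C$ ($r \in N_R$). An interpretation $\mathcal{I} = (\Delta, \cdot^{\mathcal{I}})$ assigns $A^{\mathcal{I}} \subseteq \Delta$ to concept names and $r^{\mathcal{I}} \subseteq \Delta^2$ to roles, with $(C_1 \sqcap C_2)^{\mathcal{I}} = C_1^{\mathcal{I}} \cap C_2^{\mathcal{I}}$ and $(\exists r.C)^{\mathcal{I}} = \{x \mid \exists y ((x,y) \in r^{\mathcal{I}}, y \in C^{\mathcal{I}})\}$. A CBox is a union $GCI \cup \mathcal{R}$ of a finite set $GCI$ of general concept inclusions $C \sqsubseteq D$ and a finite set $\mathcal{R}$ of role inclusions of the form $r \sqsubseteq s$ or $r_1 \circ r_2 \sqsubseteq s$ ($\mathcal{EL}^+$); in $\mathcal{EL}$ there are no role inclusions. $\mathcal{I}$ is a model of the CBox if $C^{\mathcal{I}} \subseteq D^{\mathcal{I}}$ for all GCIs and $r^{\mathcal{I}} \subseteq s^{\mathcal{I}}$, resp. $r_1^{\mathcal{I}} \circ r_2^{\mathcal{I}} \subseteq s^{\mathcal{I}}$, for all role inclusions; $\mathcal{C} \models C \sqsubseteq D$ iff $C^{\mathcal{I}} \subseteq D^{\mathcal{I}}$ in every model $\mathcal{I}$ of $\mathcal{C}$. $\Theta_{\mathcal{R}}$-sharing: let $\mathcal{R} = \mathcal{R}_A \cup \mathcal{R}_B$; for role names $r, s$ let $r \sim_{\mathcal{R}}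 s$ iff they occur in a common role inclusion of $\mathcal{R}$, $\sim^*_{\mathcal{R}}$ the generated equivalence relation, and $\Theta_{\mathcal{R}}(N) = \{ s \mid s \sim^*_{\mathcal{R}} r \text{ for some } r \in N\}$. $N_A$ ($N_B$) is the set of role names occurring in $GCI_A$ or $C$ (resp. $GCI_B$ or $D$). -}

module Defs where

open import Level using (Level; _⊔_) renaming (suc to lsuc; zero to lzero)
open import Data.List using (List; []; _∷_; _++_)
open import Data.List.Membership.Propositional using (_∈_)
open import Data.Product using (Σ; ∃; _×_; _,_)
open import Data.Sum using (_⊎_)
open import Relation.Binary.PropositionalEquality using (_≡_)
open import Relation.Binary.Construct.Closure.Equivalence using (EqClosure)

-- EL concept descriptions (no ⊤, as in the paper's context).
data Concept (NC NR : Set) : Set where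
  atom : NC → Concept NC NR
  _⊓_  : Concept NC NR → Concept NC NR → Concept NC NR
  ex   : NR → Concept NC NR → Concept NC NR

record GCI (NC NR : Set) : Set where
  constructor _⊑_
  field
    lhs : Concept NC NR
    rhs : Concept NC NR

data RI (NR : Set) : Set where
  incl : NR → NR → RI NR
  comp : NR → NR → NR → RI NR

record CBox (NC NR : Set) : Set where
  constructor cbox
  field
    gcis  : List (GCI NC NR)
    rincl : List (RI NR)
open CBox public

_∪_ : {NC NR : Set} → CBox NC NR → CBox NC NR → CBox NC NR
cbox G₁ R₁ ∪ cbox G₂ R₂ = cbox (G₁ ++ G₂) (R₁ ++ R₂)

record Interp (NC NR : Set) : Set₁ where
  field
    Δ    : Set
    conc : NC → Δ → Set
    role : NR → Δ → Δ → Set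
open Interp public

⟦_⟧ : {NC NR : Set} → Concept NC NR → (I : Interp NC NR) → Δ I → Set
⟦ atom A ⟧ I x = conc I A x
⟦ C ⊓ D ⟧ I x = ⟦ C ⟧ I x × ⟦ D ⟧ I x
⟦ ex r C ⟧ I x = Σ (Δ I) λ y → role I r x y × ⟦ C ⟧ I y

satGCI : {NC NR : Set} → Interp NC NR → GCI NC NR → Set
satGCI I (C ⊑ D) = ∀ x → ⟦ C ⟧ I x → ⟦ D ⟧ I x

satRI : {NC NR : Set} → Interp NC NR → RI NR → Set
satRI I (incl r s) = ∀ x y → role I r x y → role I s x y
satRI I (comp r₁ r₂ s) = ∀ x y z → role I r₁ x y → role I r₂ y z → role I s x z

Model : {NC NR : Set} → Interp NC NR → CBox NC NR → Set
Model I 𝒞 = (∀ g → g ∈ gcis 𝒞 → satGCI I g) × (∀ ρ → ρ ∈ rincl 𝒞 → satRI I ρ)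

_⊨_⊑_ : {NC NR : Set} → CBox NC NR → Concept NC NR → Concept NC NR → Set₁
𝒞 ⊨ C ⊑ D = ∀ (I : Interp _ _) → Model I 𝒞 → ∀ x → ⟦ C ⟧ I x → ⟦ D ⟧ I x

data CNameIn {NC NR : Set} (A : NC) : Concept NC NR → Set where
  here  : CNameIn A (atom A)
  left  : ∀ {C D} → CNameIn A C → CNameIn A (C ⊓ D)
  right : ∀ {C D} → CNameIn A D → CNameIn A (C ⊓ D)
  under : ∀ {r C} → CNameIn A C → CNameIn A (ex r C)

data RNameIn {NC NR : Set} (r : NR) : Concept NC NR → Set where
  here  : ∀ {C} → RNameIn r (ex r C)
  left  : ∀ {C D} → RNameIn r C → RNameIn r (C ⊓ D)
  right : ∀ {C D} → RNameIn r D → RNameIn r (C ⊓ D)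
  under : ∀ {s C} → RNameIn r C → RNameIn r (ex s C)

CNameInGCIs : {NC NR : Set} → NC → List (GCI NC NR) → Set
CNameInGCIs A G = ∃ λ g → g ∈ G × (CNameIn A (GCI.lhs g) ⊎ CNameIn A (GCI.rhs g))

RNameInGCIs : {NC NR : Set} → NR → List (GCI NC NR) → Set
RNameInGCIs r G = ∃ λ g → g ∈ G × (RNameIn r (GCI.lhs g) ⊎ RNameIn r (GCI.rhs g))

-- concept name occurs in the CBox 𝒞 or in the concept C
-- (role inclusions contain no concept names)
CNameInCBoxOr : {NC NR : Set} → NC → CBox NC NR → Concept NC NR → Set
CNameInCBoxOr A 𝒞 C = CNameInGCIs A (gcis 𝒞) ⊎ CNameIn A C

-- N_A-style role signature: role names occurring in GCI or C
RoleSig : {NC NR : Set} → List (GCI NC NR) → Concept NC NR → NR → Set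
RoleSig G C r = RNameInGCIs r G ⊎ RNameIn r C

RIRole : {NR : Set} → NR → RI NR → Set
RIRole r (incl s t) = r ≡ s ⊎ r ≡ t
RIRole r (comp s t u) = r ≡ s ⊎ r ≡ t ⊎ r ≡ u

_∼[_]_ : {NR : Set} → NR → List (RI NR) → NR → Set
r ∼[ R ] s = ∃ λ ρ → ρ ∈ R × RIRole r ρ × RIRole s ρ

_∼*[_]_ : {NR : Set} → NR → List (RI NR) → NR → Set
r ∼*[ R ] s = EqClosure (λ a b → a ∼[ R ] b) r s

Θ : {NR : Set} → List (RI NR) → (NR → Set) → NR → Set
Θ R N s = ∃ λ r → N r × s ∼*[ R ] r

-- Build a canonical model from the derivation calculus of the CBox.  Its
-- points are concepts c tagged with a side.  Every concept true at a point is
-- derived by c; concepts of the A-signature derived by c are true there; and a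
-- concept X of the B-signature is true exactly when c derives it, at A-side
-- points through some c ⊢ T ⊢ X with T in the shared signature.  Both halves
-- of the CBox hold in this model; C holds at the A-side point of C, hence so
-- does D, and the B-side truth of D there exhibits the interpolant T.
module Submission where

open import Defs
open import Function using (_∘_)
open import Data.Product using (Σ; _×_; _,_; proj₁; proj₂)
open import Data.List using (List; _++_)
open import Data.Sum using (_⊎_; inj₁; inj₂)
open import Relation.Binary.PropositionalEquality using (refl)
open import Data.List.Membership.Propositional using (_∈_)
open import Data.List.Membership.Propositional.Properties using (∈-++⁻)
open import Relation.Binary.Construct.Closure.ReflexiveTransitive using (ε; _◅_)
open import Relation.Binary.Construct.Closure.Symmetric using (bwd)

record Signature (NC NR : Set) : Set₁ where
  field
    concepts : NC → Set
    roles    : NR → Set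
open Signature

_∩_ : {NC NR : Set} → Signature NC NR → Signature NC NR → Signature NC NR
𝒮 ∩ 𝒯 = record { concepts = λ A → concepts 𝒮 A × concepts 𝒯 A
               ; roles    = λ r → roles 𝒮 r × roles 𝒯 r }

InSig : {NC NR : Set} → Signature NC NR → Concept NC NR → Set
InSig 𝒮 X = (∀ A → CNameIn A X → concepts 𝒮 A) × (∀ r → RNameIn r X → roles 𝒮 r)

InSigGCI : {NC NR : Set} → Signature NC NR → GCI NC NR → Set
InSigGCI 𝒮 (C ⊑ D) = InSig 𝒮 C × InSig 𝒮 D

module _ {NC NR : Set} {𝒮 : Signature NC NR} where

  InSig-atom⁺ : ∀ {A} → concepts 𝒮 A → InSig 𝒮 (atom A)
  InSig-atom⁺ a = (λ { _ here → a }) , (λ _ ())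

  InSig-⊓⁺ : ∀ {X Y} → InSig 𝒮 X → InSig 𝒮 Y → InSig 𝒮 (X ⊓ Y)
  InSig-⊓⁺ (cx , rx) (cy , ry) =
    (λ { A (left o) → cx A o ; A (right o) → cy A o }) ,
    (λ { r (left o) → rx r o ; r (right o) → ry r o })

  InSig-ex⁺ : ∀ {r X} → roles 𝒮 r → InSig 𝒮 X → InSig 𝒮 (ex r X)
  InSig-ex⁺ rr (cx , rx) = (λ { A (under o) → cx A o }) , (λ { _ here → rr ; s (under o) → rx s o })

  InSig-⊓⁻ˡ : ∀ {X Y} → InSig 𝒮 (X ⊓ Y) → InSig 𝒮 X
  InSig-⊓⁻ˡ (c , r) = (λ A → c A ∘ left) , (λ s → r s ∘ left)

  InSig-⊓⁻ʳ : ∀ {X Y} → InSig 𝒮 (X ⊓ Y) → InSig 𝒮 Y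
  InSig-⊓⁻ʳ (c , r) = (λ A → c A ∘ right) , (λ s → r s ∘ right)

  InSig-ex⁻ : ∀ {r X} → InSig 𝒮 (ex r X) → InSig 𝒮 X
  InSig-ex⁻ (c , r) = (λ A → c A ∘ under) , (λ s → r s ∘ under)

  InSig-role⁻ : ∀ {r X} → InSig 𝒮 (ex r X) → roles 𝒮 r
  InSig-role⁻ (_ , r) = r _ here

module Interpolation {NC NR : Set} (𝒦 : CBox NC NR) where

  infix 4 _⊢_
  data _⊢_ : Concept NC NR → Concept NC NR → Set where
    ⊢-refl  : ∀ {X} → X ⊢ X
    ⊢-trans : ∀ {X Y Z} → X ⊢ Y → Y ⊢ Z → X ⊢ Z
    ⊓-intro : ∀ {X Y Z} → X ⊢ Y → X ⊢ Z → X ⊢ Y ⊓ Z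
    ⊓-elimˡ : ∀ {X Y} → X ⊓ Y ⊢ X
    ⊓-elimʳ : ∀ {X Y} → X ⊓ Y ⊢ Y
    ex-mono : ∀ {r X Y} → X ⊢ Y → ex r X ⊢ ex r Y
    axiom   : ∀ {X Y} → X ⊑ Y ∈ gcis 𝒦 → X ⊢ Y
    role-incl : ∀ {r s X} → incl r s ∈ rincl 𝒦 → ex r X ⊢ ex s X
    role-comp : ∀ {r s t X} → comp r s t ∈ rincl 𝒦 → ex r (ex s X) ⊢ ex t X

  sound : ∀ {X Y} → X ⊢ Y → 𝒦 ⊨ X ⊑ Y
  sound ⊢-refl I M x h = h
  sound (⊢-trans p q) I M x h = sound q I M x (sound p I M x h)
  sound (⊓-intro p q) I M x h = sound p I M x h , sound q I M x h
  sound ⊓-elimˡ I M x (h , _) = h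
  sound ⊓-elimʳ I M x (_ , h) = h
  sound (ex-mono p) I M x (y , xy , hy) = y , xy , sound p I M y hy
  sound (axiom m) I M x h = proj₁ M _ m x h
  sound (role-incl m) I M x (y , xy , hy) = y , proj₂ M _ m x y xy , hy
  sound (role-comp m) I M x (y , xy , z , yz , hz) = z , proj₂ M _ m x y z xy yz , hz

  data Side : Set where
    a-side b-side : Side

  Point : Set
  Point = Concept NC NR × Side

  infix 4 _⊢ₚ_
  _⊢ₚ_ : Point → Concept NC NR → Set
  (c , _) ⊢ₚ X = c ⊢ X

  module CanonicalModel (ΣA ΣB : Signature NC NR) where

    infix 4 _⊢ₛ_
    _⊢ₛ_ : Point → Concept NC NR → Set
    (c , a-side) ⊢ₛ X = Σ (Concept NC NR) λ T → InSig (ΣA ∩ ΣB) T × c ⊢ T × T ⊢ X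
    (c , b-side) ⊢ₛ X = c ⊢ X

    ⊢ₛ⇒⊢ₚ : ∀ p {X} → p ⊢ₛ X → p ⊢ₚ X
    ⊢ₛ⇒⊢ₚ (c , a-side) (_ , _ , cT , TX) = ⊢-trans cT TX
    ⊢ₛ⇒⊢ₚ (c , b-side) cX = cX

    ⊢ₚ⇒⊢ₛ : ∀ p {X} → InSig (ΣA ∩ ΣB) X → p ⊢ₚ X → p ⊢ₛ X
    ⊢ₚ⇒⊢ₛ (c , a-side) shared cX = _ , shared , cX , ⊢-refl
    ⊢ₚ⇒⊢ₛ (c , b-side) shared cX = cX

    ⊢ₛ-trans : ∀ p {X Y} → p ⊢ₛ X → X ⊢ Y → p ⊢ₛ Y
    ⊢ₛ-trans (c , a-side) (T , shared , cT , TX) XY = T , shared , cT , ⊢-trans TX XY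
    ⊢ₛ-trans (c , b-side) cX XY = ⊢-trans cX XY

    ⊢ₛ-⊓ : ∀ p {X Y} → p ⊢ₛ X → p ⊢ₛ Y → p ⊢ₛ X ⊓ Y
    ⊢ₛ-⊓ (c , a-side) (T , sT , cT , TX) (U , sU , cU , UY) =
      T ⊓ U , InSig-⊓⁺ sT sU , ⊓-intro cT cU ,
      ⊓-intro (⊢-trans ⊓-elimˡ TX) (⊢-trans ⊓-elimʳ UY)
    ⊢ₛ-⊓ (c , b-side) cX cY = ⊓-intro cX cY

    canonical : Interp NC NR
    canonical = record
      { Δ    = Point
      ; conc = λ A p → (concepts ΣA A × p ⊢ₚ atom A) ⊎ p ⊢ₛ atom A
      ; role = λ r p q → (∀ X → q ⊢ₚ X → p ⊢ₚ ex r X)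
                       × (roles ΣB r → ∀ X → q ⊢ₛ X → p ⊢ₛ ex r X)
      }

    ⟦⟧⇒⊢ₚ : ∀ X p → ⟦ X ⟧ canonical p → p ⊢ₚ X
    ⟦⟧⇒⊢ₚ (atom A) p (inj₁ (_ , pA)) = pA
    ⟦⟧⇒⊢ₚ (atom A) p (inj₂ pA) = ⊢ₛ⇒⊢ₚ p pA
    ⟦⟧⇒⊢ₚ (X ⊓ Y) p (hX , hY) = ⊓-intro (⟦⟧⇒⊢ₚ X p hX) (⟦⟧⇒⊢ₚ Y p hY)
    ⟦⟧⇒⊢ₚ (ex r X) p (q , (pq , _) , hX) = pq X (⟦⟧⇒⊢ₚ X q hX)

    ⟦⟧⇒⊢ₛ : ∀ X p → InSig ΣB X → ⟦ X ⟧ canonical p → p ⊢ₛ X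
    ⟦⟧⇒⊢ₛ (atom A) p sig (inj₁ (a , pA)) = ⊢ₚ⇒⊢ₛ p (InSig-atom⁺ (a , proj₁ sig A here)) pA
    ⟦⟧⇒⊢ₛ (atom A) p sig (inj₂ pA) = pA
    ⟦⟧⇒⊢ₛ (X ⊓ Y) p sig (hX , hY) =
      ⊢ₛ-⊓ p (⟦⟧⇒⊢ₛ X p (InSig-⊓⁻ˡ sig) hX) (⟦⟧⇒⊢ₛ Y p (InSig-⊓⁻ʳ sig) hY)
    ⟦⟧⇒⊢ₛ (ex r X) p sig (q , (_ , pq) , hX) =
      pq (InSig-role⁻ sig) X (⟦⟧⇒⊢ₛ X q (InSig-ex⁻ sig) hX)

    -- The witness of ∃r.X is the A-side point of X: the shared part of any
    -- derivation from it can be prefixed by ∃r, since r lies in both signatures.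
    ⊢ₚ⇒⟦⟧ : ∀ X p → InSig ΣA X → p ⊢ₚ X → ⟦ X ⟧ canonical p
    ⊢ₚ⇒⟦⟧ (atom A) p sig pA = inj₁ (proj₁ sig A here , pA)
    ⊢ₚ⇒⟦⟧ (X ⊓ Y) p sig pXY =
      ⊢ₚ⇒⟦⟧ X p (InSig-⊓⁻ˡ sig) (⊢-trans pXY ⊓-elimˡ) ,
      ⊢ₚ⇒⟦⟧ Y p (InSig-⊓⁻ʳ sig) (⊢-trans pXY ⊓-elimʳ)
    ⊢ₚ⇒⟦⟧ (ex r X) p@(c , _) sig cX =
      (X , a-side) ,
      ((λ Y XY → ⊢-trans cX (ex-mono XY)) ,
       (λ rB Y → λ { (T , shared , XT , TY) →
          ⊢ₛ-trans p (⊢ₚ⇒⊢ₛ p (InSig-ex⁺ (InSig-role⁻ sig , rB) shared)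
                               (⊢-trans cX (ex-mono XT)))
                     (ex-mono TY) })) ,
      ⊢ₚ⇒⟦⟧ X (X , a-side) (InSig-ex⁻ sig) ⊢-refl

    ⊢ₛ⇒⟦⟧ : ∀ X p → InSig ΣB X → p ⊢ₛ X → ⟦ X ⟧ canonical p
    ⊢ₛ⇒⟦⟧ (atom A) p sig pA = inj₂ pA
    ⊢ₛ⇒⟦⟧ (X ⊓ Y) p sig pXY =
      ⊢ₛ⇒⟦⟧ X p (InSig-⊓⁻ˡ sig) (⊢ₛ-trans p pXY ⊓-elimˡ) ,
      ⊢ₛ⇒⟦⟧ Y p (InSig-⊓⁻ʳ sig) (⊢ₛ-trans p pXY ⊓-elimʳ)
    ⊢ₛ⇒⟦⟧ (ex r X) p sig pX =
      (X , b-side) ,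
      ((λ Y XY → ⊢-trans (⊢ₛ⇒⊢ₚ p pX) (ex-mono XY)) ,
       (λ _ Y XY → ⊢ₛ-trans p pX (ex-mono XY))) ,
      ⊢ₛ⇒⟦⟧ X (X , b-side) (InSig-ex⁻ sig) ⊢-refl

    canonical-model :
      (∀ g → g ∈ gcis 𝒦 → InSigGCI ΣA g ⊎ InSigGCI ΣB g) →
      (∀ {a b} → a ∼[ rincl 𝒦 ] b → roles ΣB a → roles ΣB b) →
      Model canonical 𝒦
    canonical-model split closed = satisfies-gcis , satisfies-ris
      where
      satisfies-gcis : ∀ g → g ∈ gcis 𝒦 → satGCI canonical g
      satisfies-gcis (X ⊑ Y) m with split _ m
      ... | inj₁ (_ , sigY) = λ p hX → ⊢ₚ⇒⟦⟧ Y p sigY (⊢-trans (⟦⟧⇒⊢ₚ X p hX) (axiom m))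
      ... | inj₂ (sigX , sigY) = λ p hX →
              ⊢ₛ⇒⟦⟧ Y p sigY (⊢ₛ-trans p (⟦⟧⇒⊢ₛ X p sigX hX) (axiom m))

      satisfies-ris : ∀ ρ → ρ ∈ rincl 𝒦 → satRI canonical ρ
      satisfies-ris (incl r s) m p q (pq , pqₛ) =
        (λ X qX → ⊢-trans (pq X qX) (role-incl m)) ,
        (λ sB X qX → ⊢ₛ-trans p (pqₛ (closed (_ , m , inj₂ refl , inj₁ refl) sB) X qX)
                                 (role-incl m))
      satisfies-ris (comp r s t) m p q o (pq , pqₛ) (qo , qoₛ) =
        (λ X oX → ⊢-trans (pq (ex s X) (qo X oX)) (role-comp m)) ,
        (λ tB X oX →
          ⊢ₛ-trans p (pqₛ (closed (_ , m , inj₂ (inj₂ refl) , inj₁ refl) tB) (ex s X)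
                          (qoₛ (closed (_ , m , inj₂ (inj₂ refl) , inj₂ (inj₁ refl)) tB) X oX))
                     (role-comp m))

  open CanonicalModel

  interpolant : (ΣA ΣB : Signature NC NR) {C D : Concept NC NR} →
    (∀ g → g ∈ gcis 𝒦 → InSigGCI ΣA g ⊎ InSigGCI ΣB g) →
    (∀ {a b} → a ∼[ rincl 𝒦 ] b → roles ΣB a → roles ΣB b) →
    InSig ΣA C → InSig ΣB D → 𝒦 ⊨ C ⊑ D →
    Σ (Concept NC NR) λ T → InSig (ΣA ∩ ΣB) T × 𝒦 ⊨ C ⊑ T × 𝒦 ⊨ T ⊑ D
  interpolant ΣA ΣB {C} {D} split closed sigC sigD C⊑D
    with ⟦⟧⇒⊢ₛ ΣA ΣB D (C , a-side) sigD
           (C⊑D (canonical ΣA ΣB) (canonical-model ΣA ΣB split closed) (C , a-side)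
                (⊢ₚ⇒⟦⟧ ΣA ΣB C (C , a-side) sigC ⊢-refl))
  ... | T , shared , CT , TD = T , shared , sound CT , sound TD

Θ-resp-∼ : ∀ {NR : Set} {R : List (RI NR)} {N : NR → Set} {a b} →
  a ∼[ R ] b → Θ R N a → Θ R N b
Θ-resp-∼ a∼b (r , Nr , a∼*r) = r , Nr , bwd a∼b ◅ a∼*r

ΘSig : {NC NR : Set} → List (RI NR) → CBox NC NR → Concept NC NR → Signature NC NR
ΘSig R 𝒞 C = record { concepts = λ A → CNameInCBoxOr A 𝒞 C ; roles = Θ R (RoleSig (gcis 𝒞) C) }

module _ {NC NR : Set} (R : List (RI NR)) (𝒞 : CBox NC NR) (C : Concept NC NR) where

  ΘSig-gcis : ∀ g → g ∈ gcis 𝒞 → InSigGCI (ΘSig R 𝒞 C) g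
  ΘSig-gcis (X ⊑ Y) m =
    ((λ A o → inj₁ (_ , m , inj₁ o)) , (λ r o → r , inj₁ (_ , m , inj₁ o) , ε)) ,
    ((λ A o → inj₁ (_ , m , inj₂ o)) , (λ r o → r , inj₁ (_ , m , inj₂ o) , ε))

  ΘSig-concept : InSig (ΘSig R 𝒞 C) C
  ΘSig-concept = (λ A o → inj₂ o) , (λ r o → r , inj₂ o , ε)

corollary14 : {NC NR : Set} (𝒞A 𝒞B : CBox NC NR) (C D : Concept NC NR) →
    (𝒞A ∪ 𝒞B) ⊨ C ⊑ D →
    Σ (Concept NC NR) λ T →
      (∀ A → CNameIn A T → CNameInCBoxOr A 𝒞A C × CNameInCBoxOr A 𝒞B D) ×
      (∀ r → RNameIn r T →
        Θ (rincl 𝒞A ++ rincl 𝒞B) (RoleSig (gcis 𝒞A) C) r ×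
        Θ (rincl 𝒞A ++ rincl 𝒞B) (RoleSig (gcis 𝒞B) D) r) ×
      ((𝒞A ∪ 𝒞B) ⊨ C ⊑ T) ×
      ((𝒞A ∪ 𝒞B) ⊨ T ⊑ D)
corollary14 𝒞A@(cbox GA RA) 𝒞B@(cbox GB RB) C D C⊑D
  with Interpolation.interpolant (𝒞A ∪ 𝒞B) (ΘSig R 𝒞A C) (ΘSig R 𝒞B D)
         split Θ-resp-∼ (ΘSig-concept R 𝒞A C) (ΘSig-concept R 𝒞B D) C⊑D
  where
  R = RA ++ RB
  split : ∀ g → g ∈ GA ++ GB → InSigGCI (ΘSig R 𝒞A C) g ⊎ InSigGCI (ΘSig R 𝒞B D) g
  split g m with ∈-++⁻ GA m
  ... | inj₁ mA = inj₁ (ΘSig-gcis R 𝒞A C g mA)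
  ... | inj₂ mB = inj₂ (ΘSig-gcis R 𝒞B D g mB)
... | T , (concepts-shared , roles-shared) , C⊑T , T⊑D =
  T , concepts-shared , roles-shared , C⊑T , T⊑D
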